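{- Let $S$ be a read-$2$ per-read-monotone sequence over $X=\{x_1,\dots,x_s\}$. Then there is $X'\subseteq X$ with $|X'|\ge s/3$ such that $S|_{X'}$ is per-read-monotone and $2$-regularly-interleaving.
   Context: A sequence $S$ of elements of a finite set $X$ is read-$k$ if every element of $X$ occurs exactly $k$ times. For $i\in[k]$, $S^{(i)}$ is the subsequence of $i$-th occurrences. For $X'\subseteq X$, $S|_{X'}$ is obtained by deleting all occurrences of elements of $X\setminus X'$. The elements are labeled $x_1,\dots,x_s$ in the order of their first occurrence in $S$, and $X$ is ordered $x_1<\dots<x_s$. A read-$k$ sequence is per-read-monotone if every $S^{(i)}$ is monotone (increasing or decreasing) in this order. A read-$2$ sequence over $X$ is $2$-regularly-interleaving if there is a partition of $X$ into blocks $X_1,\dots,X_t$ such that for every block $X_i$: for each $c\in\{1,2\}$, the $c$-th occurrences of the elements of $X_i$ form a contiguous interval of the sequence, and the interval of second occurrences of $X_i$ immediately follows the interval of first occurrences of $X_i$. -}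

module Defs where

open import Data.Nat using (ℕ; zero; suc; _≤_; _<_; _>_; _*_)
open import Data.Nat.Properties using ()
open import Data.Fin using (Fin; toℕ)
open import Data.Fin.Subset using (Subset; _∈_; ∣_∣)
open import Data.Fin.Subset.Properties using (_∈?_)
open import Data.List using (List; []; _∷_; map; filter; length; lookup)
open import Data.List.Relation.Unary.Linked using (Linked)
open import Data.Product using (_×_; _,_; proj₁; proj₂; ∃-syntax; Σ-syntax)
open import Data.Sum using (_⊎_)
open import Function.Bundles using (_⇔_)
open import Relation.Nullary using (Dec; yes; no)
open import Relation.Binary.PropositionalEquality using (_≡_)
open import Relation.Binary.Definitions using (DecidableEquality)
open import Data.Nat using (_≟_)

module _ {A : Set} (_≟A_ : DecidableEquality A) where

  occCount : A → List A → ℕ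
  occCount x [] = 0
  occCount x (y ∷ ys) with x ≟A y
  ... | yes _ = suc (occCount x ys)
  ... | no  _ = occCount x ys

  -- label every position of the sequence with (element, occurrence number),
  -- occurrence numbers starting at 1
  labelOcc : List A → List A → List (A × ℕ)
  labelOcc seen [] = []
  labelOcc seen (x ∷ xs) = (x , suc (occCount x seen)) ∷ labelOcc (x ∷ seen) xs

  occs : List A → List (A × ℕ)
  occs S = labelOcc [] S

  readSeq : List A → ℕ → List A
  readSeq S i = map proj₁ (filter (λ p → proj₂ p ≟ i) (occs S))

  -- index of the first occurrence of x in S (= rank of x in the order x₁ < x₂ < …)
  firstIdx : List A → A → ℕ
  firstIdx [] x = 0
  firstIdx (y ∷ ys) x with x ≟A y
  ... | yes _ = 0
  ... | no  _ = suc (firstIdx ys x)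

  -- read-k: every element of X occurs exactly k times
  -- (here X is the whole type A; used with A = Fin s)
  ReadK : ℕ → List A → Set
  ReadK k S = ∀ x → occCount x S ≡ k

  MonotoneIn : List A → List A → Set
  MonotoneIn S ys =
    Linked (λ a b → firstIdx S a < firstIdx S b) ys
    ⊎ Linked (λ a b → firstIdx S a > firstIdx S b) ys

  PerReadMonotone : ℕ → List A → Set
  PerReadMonotone k S = ∀ i → 1 ≤ i → i ≤ k → MonotoneIn S (readSeq S i)

  -- 2-regularly-interleaving: a partition of the elements into blocks
  -- (given by a block-labelling blk) such that, for every block β, the
  -- first occurrences of β occupy exactly the positions [a, m) and the
  -- second occurrences of β occupy exactly the positions [m, e).
  TwoRegInterleaving : List A → Set
  TwoRegInterleaving S =
    Σ[ blk ∈ (A → ℕ) ] ∀ (β : ℕ) → ∃[ a ] ∃[ m ] ∃[ e ] (a ≤ m × m ≤ e ×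
      (∀ (p : Fin (length (occs S))) →
        ((blk (proj₁ (lookup (occs S) p)) ≡ β × proj₂ (lookup (occs S) p) ≡ 1)
           ⇔ (a ≤ toℕ p × toℕ p < m))
        × ((blk (proj₁ (lookup (occs S) p)) ≡ β × proj₂ (lookup (occs S) p) ≡ 2)
           ⇔ (m ≤ toℕ p × toℕ p < e))))

restrict : ∀ {s} → List (Fin s) → Subset s → List (Fin s)
restrict S X' = filter (λ x → x ∈? X') S

module Submission where

-- The first read S⁽¹⁾ is always increasing in
-- the order of first occurrence, so only the direction of S⁽²⁾ matters.
--
-- * S⁽²⁾ decreasing: no first occurrence can follow a second one (an element
--   pushed after x would have to be read again before x), so S is S⁽¹⁾ followed
--   by S⁽²⁾, one block, and X' = X works.
-- * S⁽²⁾ increasing: then S⁽²⁾ = S⁽¹⁾, i.e. S is a run of a FIFO queue.  A small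
--   machine assigns each element a generation: a new generation opens at the
--   first push after an element of the current generation has been popped.  On
--   the elements of generations of one parity, the events appear sorted by the
--   block key 2·gen + (label − 1); the larger parity class has ≥ s/2 elements.

open import Defs
open import Data.Nat using (ℕ; zero; suc; _+_; _≤_; _<_; _>_; _*_; _∸_; z≤n; s≤s)
open import Data.Nat.Properties
  using (≤-pred; ≮⇒≥; ≤-reflexive; n≤1+n; m≤m+n; m∸n≤m; +-monoʳ-≤; +-comm; ≤-antisym; +-suc;
         +-identityʳ; <-irrefl; <-trans; <-asym; ≤-refl; ≤-trans; m≤n⇒m<n∨m≡n; suc-injective;
         ≤-total; +-mono-≤; m+[n∸m]≡n; 0≢1+n; *-monoˡ-≤)
import Data.Nat as N
open import Data.Bool using (Bool; true; false; not; _∨_; _xor_; if_then_else_)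
open import Data.Bool.Properties using (∨-zeroʳ; ∨-identityʳ; xor-same; not-¬; ¬-not)
open import Data.Fin using (Fin; toℕ) renaming (zero to fzero; suc to fsuc)
open import Data.Fin.Properties using (_≟_)
open import Data.Fin.Subset using (Subset; ∣_∣; ∁; ⊤) renaming (_∈_ to _∈S_)
open import Data.Fin.Subset.Properties using (_∈?_; ∈⊤; ∣⊤∣≡n; x∈∁p⇒x∉p; x∉p⇒x∈∁p; ∣∁p∣≡n∸∣p∣; ∣p∣≤n)
open import Data.Vec using (tabulate)
open import Data.Vec.Properties using (lookup∘tabulate; []=⇒lookup; lookup⇒[]=)
open import Data.List using (List; []; _∷_; map; filter; length; lookup; _++_)
open import Data.List.Properties using (filter-accept; filter-reject; filter-all; ++-assoc; ∷-injective)
open import Data.List.Membership.Propositional using () renaming (_∈_ to _∈L_; _∉_ to _∉L_)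
open import Data.List.Membership.Propositional.Properties using (∈-++⁺ˡ; ∈-++⁺ʳ; ∈-lookup)
open import Data.List.Relation.Unary.Any using (here; there)
open import Data.List.Relation.Unary.All as All using (All; []; _∷_)
import Data.List.Relation.Unary.All.Properties as AllP
open import Data.List.Relation.Unary.AllPairs as AP using (AllPairs; []; _∷_)
import Data.List.Relation.Unary.AllPairs.Properties as APP
open import Data.List.Relation.Unary.Linked using (Linked; []; [-]; _∷_)
import Data.List.Relation.Unary.Linked.Properties as LP
open import Data.Product using (_×_; _,_; proj₁; proj₂; ∃-syntax)
open import Data.Sum using (_⊎_; inj₁; inj₂; [_,_]′)
open import Data.Empty using (⊥-elim)
open import Function.Bundles using (_⇔_; mk⇔; Equivalence)
open import Function.Construct.Composition using (_⇔-∘_)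
open import Function.Construct.Symmetry using (⇔-sym)
open import Relation.Nullary using (Dec; yes; no; ¬_; does)
import Relation.Nullary.Decidable as D
open import Relation.Unary using (Decidable)
open import Relation.Binary.PropositionalEquality using (_≡_; _≢_; refl; sym; trans; cong; cong₂; subst; subst₂; module ≡-Reasoning)
open ≡-Reasoning
open import Relation.Binary.Definitions using (DecidableEquality)

strictly-sorted-unique : ∀ {A : Set} (f : A → ℕ) (xs ys : List A) →
  AllPairs (λ a b → f a < f b) xs → AllPairs (λ a b → f a < f b) ys →
  (∀ {z} → z ∈L xs → z ∈L ys) → (∀ {z} → z ∈L ys → z ∈L xs) → xs ≡ ys
strictly-sorted-unique f [] [] _ _ _ _ = refl
strictly-sorted-unique f [] (y ∷ ys) _ _ _ ys⊆ with ys⊆ (here refl)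
... | ()
strictly-sorted-unique f (x ∷ xs) [] _ _ xs⊆ _ with xs⊆ (here refl)
... | ()
strictly-sorted-unique f (x ∷ xs) (y ∷ ys) (x< ∷ sxs) (y< ∷ sys) xs⊆ ys⊆ with xs⊆ (here refl)
... | there x∈ys = ⊥-elim (y∉ (ys⊆ (here refl)))
  where
  fy<fx : f y < f x
  fy<fx = All.lookup y< x∈ys
  y∉ : ¬ y ∈L (x ∷ xs)
  y∉ (here refl) = <-irrefl refl fy<fx
  y∉ (there y∈xs) = <-asym fy<fx (All.lookup x< y∈xs)
... | here refl = cong (x ∷_) (strictly-sorted-unique f xs ys sxs sys (tail⊆ x< y< xs⊆) (tail⊆ y< x< ys⊆))
  where
  -- the common head is strictly below every later member, so it drops out
  tail⊆ : ∀ {us vs} → All (λ b → f x < f b) us → All (λ b → f x < f b) vs →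
    (∀ {z} → z ∈L (x ∷ us) → z ∈L (x ∷ vs)) → ∀ {z} → z ∈L us → z ∈L vs
  tail⊆ x<us _ us⊆ m with us⊆ (there m)
  ... | here refl = ⊥-elim (<-irrefl refl (All.lookup x<us m))
  ... | there m' = m'

linked-map-on : ∀ {A : Set} {R R' : A → A → Set} {P : A → Set} {xs} → All P xs → Linked R xs →
  (∀ {a b} → P a → P b → R a b → R' a b) → Linked R' xs
linked-map-on _ [] _ = []
linked-map-on _ [-] _ = [-]
linked-map-on (pa ∷ pbs@(pb ∷ _)) (r ∷ rs) f = f pa pb r ∷ linked-map-on pbs rs f

allPairs-++-cross : ∀ {A : Set} {R : A → A → Set} xs {ys a b} → AllPairs R (xs ++ ys) → a ∈L xs → b ∈L ys → R a b
allPairs-++-cross (x ∷ xs) {ys} (x~ ∷ _) (here refl) b∈ = All.lookup x~ (∈-++⁺ʳ xs b∈)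
allPairs-++-cross (x ∷ xs) (_ ∷ rest) (there a∈) b∈ = allPairs-++-cross xs rest a∈ b∈

no-members : ∀ {A : Set} {L : List A} → (∀ {y} → ¬ y ∈L L) → L ≡ []
no-members {L = []} _ = refl
no-members {L = y ∷ _} ∉L = ⊥-elim (∉L (here refl))

bit : Bool → ℕ
bit true = 1
bit false = 0

bit≤1 : ∀ b → bit b ≤ 1
bit≤1 true = s≤s z≤n
bit≤1 false = z≤n

-- Passing an event with key k turns the bound b into b'; if the event is kept
-- (it belongs to the class) its key must lie between the two bounds.
Passes : Set → ℕ → ℕ → ℕ → Set
Passes kept k b b' = (kept → b ≤ k × k ≤ b') × (¬ kept → b ≤ b')

passes-⇔ : ∀ {K K' k b b'} → K ⇔ K' → Passes K' k b b' → Passes K k b b'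
passes-⇔ K⇔K' (kept , dropped) =
  (λ k → kept (Equivalence.to K⇔K' k)) , (λ ¬k → dropped (λ k' → ¬k (Equivalence.from K⇔K' k')))

module Keyed {E : Set} (key : E → ℕ) where

  data AscendingFrom (b : ℕ) : List E → Set where
    []  : AscendingFrom b []
    _∷_ : ∀ {e L} → b ≤ key e → AscendingFrom (key e) L → AscendingFrom b (e ∷ L)

  ascendingFrom-weaken : ∀ {b b' L} → b' ≤ b → AscendingFrom b L → AscendingFrom b' L
  ascendingFrom-weaken _ [] = []
  ascendingFrom-weaken b'≤b (b≤e ∷ asc) = ≤-trans b'≤b b≤e ∷ asc

  ascendingFrom⇒sorted : ∀ {b L} → AscendingFrom b L → AllPairs (λ d e → key d ≤ key e) L
  ascendingFrom⇒sorted asc = LP.Linked⇒AllPairs ≤-trans (linked asc)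
    where
    linked : ∀ {b L} → AscendingFrom b L → Linked (λ d e → key d ≤ key e) L
    linked [] = []
    linked (_ ∷ []) = [-]
    linked (_ ∷ asc@(k≤ ∷ _)) = k≤ ∷ linked asc

  ascendingFrom-filter-cons : ∀ {Q : E → Set} (Q? : Decidable Q) e L {b b'} → Passes (Q e) (key e) b b' →
    AscendingFrom b' (filter Q? L) → AscendingFrom b (filter Q? (e ∷ L))
  ascendingFrom-filter-cons Q? e L (kept , dropped) asc with Q? e
  ... | yes q = proj₁ (kept q) ∷ ascendingFrom-weaken (proj₂ (kept q)) asc
  ... | no ¬q = ascendingFrom-weaken (dropped ¬q) asc

  below : ℕ → List E → ℕ
  below K [] = 0
  below K (e ∷ L) with key e N.<? K
  ... | yes _ = suc (below K L)
  ... | no _ = below K L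

  below-mono : ∀ {K K'} L → K ≤ K' → below K L ≤ below K' L
  below-mono [] _ = z≤n
  below-mono {K} {K'} (e ∷ L) K≤K' with key e N.<? K | key e N.<? K'
  ... | yes _ | yes _ = s≤s (below-mono L K≤K')
  ... | yes k<K | no k≮K' = ⊥-elim (k≮K' (≤-trans k<K K≤K'))
  ... | no _ | yes _ = ≤-trans (below-mono L K≤K') (n≤1+n _)
  ... | no _ | no _ = below-mono L K≤K'

  below-none : ∀ {K e} L → K ≤ key e → All (λ d → key e ≤ key d) L → below K L ≡ 0
  below-none [] _ _ = refl
  below-none {K} (d ∷ L) K≤e (e≤d ∷ e≤L) with key d N.<? K
  ... | yes d<K = ⊥-elim (<-irrefl refl (≤-trans d<K (≤-trans K≤e e≤d)))
  ... | no _ = below-none L K≤e e≤L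

  below-lookup : ∀ {K} L → AllPairs (λ d e → key d ≤ key e) L → (p : Fin (length L)) →
    toℕ p < below K L ⇔ key (lookup L p) < K
  below-lookup L sorted p = mk⇔ (to L sorted p) (from L sorted p)
    where
    to : ∀ {K} L → AllPairs (λ d e → key d ≤ key e) L → (p : Fin (length L)) →
      toℕ p < below K L → key (lookup L p) < K
    to {K} (e ∷ L) (e≤ ∷ sorted) p p< with key e N.<? K
    to (e ∷ L) (e≤ ∷ sorted) fzero p< | yes e<K = e<K
    to (e ∷ L) (e≤ ∷ sorted) (fsuc p) p< | yes _ = to L sorted p (≤-pred p<)
    ... | no e≮K = ⊥-elim (<-irrefl (sym (below-none L (≮⇒≥ e≮K) e≤)) (≤-trans (s≤s z≤n) p<))
    from : ∀ {K} L → AllPairs (λ d e → key d ≤ key e) L → (p : Fin (length L)) →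
      key (lookup L p) < K → toℕ p < below K L
    from {K} (e ∷ L) (e≤ ∷ sorted) p k< with key e N.<? K
    from (e ∷ L) (e≤ ∷ sorted) fzero k< | yes _ = s≤s z≤n
    from (e ∷ L) (e≤ ∷ sorted) (fsuc p) k< | yes _ = s≤s (from L sorted p k<)
    from (e ∷ L) (e≤ ∷ sorted) fzero k< | no e≮K = ⊥-elim (e≮K k<)
    from (e ∷ L) (e≤ ∷ sorted) (fsuc p) k< | no e≮K =
      ⊥-elim (e≮K (≤-trans (s≤s (All.lookup e≤ (∈-lookup p))) k<))

  key-interval : ∀ {K} L → AllPairs (λ d e → key d ≤ key e) L → (p : Fin (length L)) →
    (below K L ≤ toℕ p × toℕ p < below (suc K) L) ⇔ key (lookup L p) ≡ K
  key-interval {K} L sorted p = mk⇔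
    (λ (b≤p , p<b') → ≤-antisym (≤-pred (Equivalence.to below-suc p<b'))
                                (≮⇒≥ λ k<K → <-irrefl refl (≤-trans (Equivalence.from below-K k<K) b≤p)))
    (λ { refl → ≮⇒≥ (λ p<b → <-irrefl refl (Equivalence.to below-K p<b))
              , Equivalence.from below-suc ≤-refl })
    where
    below-K : toℕ p < below K L ⇔ key (lookup L p) < K
    below-K = below-lookup L sorted p
    below-suc : toℕ p < below (suc K) L ⇔ key (lookup L p) < suc K
    below-suc = below-lookup L sorted p

-- double n = 2n, by recursion so that parity facts are plain pattern matches
double : ℕ → ℕ
double zero = zero
double (suc n) = suc (suc (double n))

double-injective : ∀ a b → double a ≡ double b → a ≡ b
double-injective zero zero _ = refl
double-injective (suc a) (suc b) eq = cong suc (double-injective a b (suc-injective (suc-injective eq)))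

odd≢double : ∀ a b → suc (double a) ≢ double b
odd≢double _ zero ()
odd≢double zero (suc _) ()
odd≢double (suc a) (suc b) eq = odd≢double a b (suc-injective (suc-injective eq))

FirstOrSecond : ∀ {A : Set} → A × ℕ → Set
FirstOrSecond e = proj₂ e ≡ 1 ⊎ proj₂ e ≡ 2

module Blocks {A : Set} (blk : A → ℕ) where

  blockKey : A × ℕ → ℕ
  blockKey e = double (blk (proj₁ e)) + (proj₂ e ∸ 1)

  open Keyed blockKey public

  first-key : ∀ β e → FirstOrSecond e → (blk (proj₁ e) ≡ β × proj₂ e ≡ 1) ⇔ blockKey e ≡ double β
  first-key β (x , c) label = mk⇔ (λ { (refl , refl) → +-identityʳ (double (blk x)) }) (from label)
    where
    from : FirstOrSecond (x , c) → blockKey (x , c) ≡ double β → blk x ≡ β × c ≡ 1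
    from (inj₁ refl) eq = double-injective (blk x) β (trans (sym (+-identityʳ _)) eq) , refl
    from (inj₂ refl) eq = ⊥-elim (odd≢double (blk x) β (trans (+-comm 1 _) eq))

  second-key : ∀ β e → FirstOrSecond e → (blk (proj₁ e) ≡ β × proj₂ e ≡ 2) ⇔ blockKey e ≡ suc (double β)
  second-key β (x , c) label = mk⇔ (λ { (refl , refl) → +-comm (double (blk x)) 1 }) (from label)
    where
    from : FirstOrSecond (x , c) → blockKey (x , c) ≡ suc (double β) → blk x ≡ β × c ≡ 2
    from (inj₁ refl) eq = ⊥-elim (odd≢double β (blk x) (sym (trans (sym (+-identityʳ _)) eq)))
    from (inj₂ refl) eq = double-injective (blk x) β (suc-injective (trans (+-comm 1 _) eq)) , refl

  interleaving-criterion : ∀ L → All FirstOrSecond L → AllPairs (λ d e → blockKey d ≤ blockKey e) L →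
    ∀ (β : ℕ) → ∃[ a ] ∃[ m ] ∃[ e ] (a ≤ m × m ≤ e ×
      (∀ (p : Fin (length L)) →
        ((blk (proj₁ (lookup L p)) ≡ β × proj₂ (lookup L p) ≡ 1) ⇔ (a ≤ toℕ p × toℕ p < m))
        × ((blk (proj₁ (lookup L p)) ≡ β × proj₂ (lookup L p) ≡ 2) ⇔ (m ≤ toℕ p × toℕ p < e))))
  interleaving-criterion L labels sorted β =
    below (double β) L , below (suc (double β)) L , below (suc (suc (double β))) L ,
    below-mono L (n≤1+n _) , below-mono L (n≤1+n _) ,
    λ p → (⇔-sym (key-interval L sorted p) ⇔-∘ first-key β (lookup L p) (label-at p))
        , (⇔-sym (key-interval L sorted p) ⇔-∘ second-key β (lookup L p) (label-at p))
    where
    label-at : (p : Fin (length L)) → FirstOrSecond (lookup L p)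
    label-at p = All.lookup labels (∈-lookup p)

-- Occurrence bookkeeping for sequences over a type with decidable equality.
-- `label seen R` labels the events of R, continuing the counts of the prefix
-- `seen` (kept in reverse order); `occs S = label [] S`.
module Occurrences {A : Set} (_≟A_ : DecidableEquality A) where

  count : A → List A → ℕ
  count = occCount _≟A_

  label : List A → List A → List (A × ℕ)
  label = labelOcc _≟A_

  rank : List A → A → ℕ
  rank = firstIdx _≟A_

  count-here : ∀ x ys → count x (x ∷ ys) ≡ suc (count x ys)
  count-here x ys with x ≟A x
  ... | yes _ = refl
  ... | no x≢x = ⊥-elim (x≢x refl)

  count-there : ∀ {x y} ys → x ≢ y → count x (y ∷ ys) ≡ count x ys
  count-there {x} {y} ys x≢y with x ≟A y
  ... | yes x≡y = ⊥-elim (x≢y x≡y)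
  ... | no _ = refl

  rank-here : ∀ x ys → rank (x ∷ ys) x ≡ 0
  rank-here x ys with x ≟A x
  ... | yes _ = refl
  ... | no x≢x = ⊥-elim (x≢x refl)

  rank-there : ∀ {x y} ys → x ≢ y → rank (y ∷ ys) x ≡ suc (rank ys x)
  rank-there {x} {y} ys x≢y with x ≟A y
  ... | yes x≡y = ⊥-elim (x≢y x≡y)
  ... | no _ = refl

  unseen-cons : ∀ {z y} seen → count z (y ∷ seen) ≡ 0 → z ≢ y × count z seen ≡ 0
  unseen-cons {z} {y} seen c≡0 with z ≟A y
  ... | no z≢y = z≢y , c≡0
  unseen-cons {z} {y} seen () | yes _

  count-cons-≢0 : ∀ {z y} seen → count z (y ∷ seen) ≢ 0 → z ≡ y ⊎ count z seen ≢ 0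
  count-cons-≢0 {z} {y} seen c≢0 with z ≟A y
  ... | yes z≡y = inj₁ z≡y
  ... | no _ = inj₂ c≢0

  unseen⇒∉ : ∀ {x} seen → count x seen ≡ 0 → x ∉L seen
  unseen⇒∉ (_ ∷ seen) c≡0 (here refl) = proj₁ (unseen-cons seen c≡0) refl
  unseen⇒∉ (_ ∷ seen) c≡0 (there x∈) = unseen⇒∉ seen (proj₂ (unseen-cons seen c≡0)) x∈

  read : ℕ → List (A × ℕ) → List A
  read i L = map proj₁ (filter (λ e → proj₂ e N.≟ i) L)

  read-accept : ∀ i x c L → c ≡ i → read i ((x , c) ∷ L) ≡ x ∷ read i L
  read-accept i x c L c≡i rewrite filter-accept (λ e → proj₂ e N.≟ i) {x = (x , c)} {xs = L} c≡i = refl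

  read-reject : ∀ i x c L → c ≢ i → read i ((x , c) ∷ L) ≡ read i L
  read-reject i x c L c≢i rewrite filter-reject (λ e → proj₂ e N.≟ i) {x = (x , c)} {xs = L} c≢i = refl

  read-⊆-cons : ∀ i {z} e L → z ∈L read i L → z ∈L read i (e ∷ L)
  read-⊆-cons i (x , c) L z∈ with c N.≟ i
  ... | yes c≡i rewrite read-accept i x c L c≡i = there z∈
  ... | no c≢i rewrite read-reject i x c L c≢i = z∈

  firsts seconds : List A → List A → List A
  firsts seen R = read 1 (label seen R)
  seconds seen R = read 2 (label seen R)

  firsts-new : ∀ seen x R → count x seen ≡ 0 → firsts seen (x ∷ R) ≡ x ∷ firsts (x ∷ seen) R
  firsts-new seen x R c≡0 = read-accept 1 x _ (label (x ∷ seen) R) (cong suc c≡0)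

  firsts-old : ∀ seen x R → count x seen ≢ 0 → firsts seen (x ∷ R) ≡ firsts (x ∷ seen) R
  firsts-old seen x R c≢0 = read-reject 1 x _ (label (x ∷ seen) R) (λ eq → c≢0 (suc-injective eq))

  seconds-now : ∀ seen x R → count x seen ≡ 1 → seconds seen (x ∷ R) ≡ x ∷ seconds (x ∷ seen) R
  seconds-now seen x R c≡1 = read-accept 2 x _ (label (x ∷ seen) R) (cong suc c≡1)

  seconds-not-now : ∀ seen x R → count x seen ≢ 1 → seconds seen (x ∷ R) ≡ seconds (x ∷ seen) R
  seconds-not-now seen x R c≢1 = read-reject 2 x _ (label (x ∷ seen) R) (λ eq → c≢1 (suc-injective eq))

  firsts-unseen : ∀ seen R → All (λ z → count z seen ≡ 0) (firsts seen R)
  firsts-unseen seen [] = []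
  firsts-unseen seen (y ∷ R) with count y seen N.≟ 0
  ... | yes c≡0 = subst (All _) (sym (firsts-new seen y R c≡0)) (c≡0 ∷ unseen-tail)
    where
    unseen-tail : All (λ z → count z seen ≡ 0) (firsts (y ∷ seen) R)
    unseen-tail = All.map (λ c≡0 → proj₂ (unseen-cons seen c≡0)) (firsts-unseen (y ∷ seen) R)
  ... | no c≢0 = subst (All _) (sym (firsts-old seen y R c≢0))
                   (All.map (λ c≡0 → proj₂ (unseen-cons seen c≡0)) (firsts-unseen (y ∷ seen) R))

  firsts-≢ : ∀ y seen R → All (_≢ y) (firsts (y ∷ seen) R)
  firsts-≢ y seen R = All.map (λ c≡0 → proj₁ (unseen-cons seen c≡0)) (firsts-unseen (y ∷ seen) R)

  rank-shift : ∀ {y R L} → All (_≢ y) L → Linked (λ a b → rank R a < rank R b) L →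
    Linked (λ a b → rank (y ∷ R) a < rank (y ∷ R) b) L
  rank-shift {y} {R} ≢y asc = linked-map-on ≢y asc
    (λ a≢y b≢y a<b → subst₂ _<_ (sym (rank-there R a≢y)) (sym (rank-there R b≢y)) (s≤s a<b))

  rank-least : ∀ {y R L} → All (_≢ y) L → Linked (λ a b → rank (y ∷ R) a < rank (y ∷ R) b) L →
    Linked (λ a b → rank (y ∷ R) a < rank (y ∷ R) b) (y ∷ L)
  rank-least [] [] = [-]
  rank-least {y} {R} (b≢y ∷ _) asc =
    subst₂ _<_ (sym (rank-here y R)) (sym (rank-there R b≢y)) (s≤s z≤n) ∷ asc

  firsts-ascending : ∀ seen R → Linked (λ a b → rank R a < rank R b) (firsts seen R)
  firsts-ascending seen [] = []
  firsts-ascending seen (y ∷ R) with count y seen N.≟ 0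
  ... | yes c≡0 = subst (Linked _) (sym (firsts-new seen y R c≡0)) (rank-least (firsts-≢ y seen R) shifted)
    where
    shifted : Linked (λ a b → rank (y ∷ R) a < rank (y ∷ R) b) (firsts (y ∷ seen) R)
    shifted = rank-shift (firsts-≢ y seen R) (firsts-ascending (y ∷ seen) R)
  ... | no c≢0 = subst (Linked _) (sym (firsts-old seen y R c≢0))
                   (rank-shift (firsts-≢ y seen R) (firsts-ascending (y ∷ seen) R))

  Balanced : List A → List A → Set
  Balanced seen R = ∀ z → count z seen + count z R ≡ 2

  balanced-step : ∀ {seen x R} → Balanced seen (x ∷ R) → Balanced (x ∷ seen) R
  balanced-step {seen} {x} {R} bal z = by-cases (z ≟A x)
    where
    by-cases : Dec (z ≡ x) → count z (x ∷ seen) + count z R ≡ 2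
    by-cases (yes refl) = begin
      count z (z ∷ seen) + count z R  ≡⟨ cong (_+ count z R) (count-here z seen) ⟩
      suc (count z seen + count z R)  ≡⟨ sym (+-suc (count z seen) (count z R)) ⟩
      count z seen + suc (count z R)  ≡⟨ cong (count z seen +_) (sym (count-here z R)) ⟩
      count z seen + count z (z ∷ R)  ≡⟨ bal z ⟩
      2                               ∎
    by-cases (no z≢x) = begin
      count z (x ∷ seen) + count z R  ≡⟨ cong₂ _+_ (count-there seen z≢x) (sym (count-there R z≢x)) ⟩
      count z seen + count z (x ∷ R)  ≡⟨ bal z ⟩
      2                               ∎

  next-occurrence : ∀ {seen x R} → Balanced seen (x ∷ R) → count x seen ≡ 0 ⊎ count x seen ≡ 1
  next-occurrence {seen} {x} {R} bal = from-sum (count x seen) (count x R)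
    (trans (cong (count x seen +_) (sym (count-here x R))) (bal x))
    where
    from-sum : ∀ a b → a + suc b ≡ 2 → a ≡ 0 ⊎ a ≡ 1
    from-sum zero _ _ = inj₁ refl
    from-sum (suc zero) _ _ = inj₂ refl
    from-sum (suc (suc a)) b eq = ⊥-elim (0≢1+n (sym (trans (sym (+-suc a b)) (suc-injective (suc-injective eq)))))

  labels-1-or-2 : ∀ seen R → Balanced seen R → All FirstOrSecond (label seen R)
  labels-1-or-2 seen [] _ = []
  labels-1-or-2 seen (x ∷ R) bal =
    [ (λ c≡0 → inj₁ (cong suc c≡0)) , (λ c≡1 → inj₂ (cong suc c≡1)) ]′ (next-occurrence {seen} {x} {R} bal)
    ∷ labels-1-or-2 (x ∷ seen) R (balanced-step {seen} {x} {R} bal)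

  ∈-read : ∀ i z seen R → count z seen < i → i ≤ count z seen + count z R → z ∈L read i (label seen R)
  ∈-read i z seen [] c<i i≤c = ⊥-elim (<-irrefl refl (≤-trans c<i (subst (i ≤_) (+-identityʳ _) i≤c)))
  ∈-read i z seen (y ∷ R) c<i i≤c = by-cases (z ≟A y)
    where
    by-cases : Dec (z ≡ y) → z ∈L read i (label seen (y ∷ R))
    by-cases (no z≢y) = read-⊆-cons i (y , suc (count y seen)) (label (y ∷ seen) R)
      (∈-read i z (y ∷ seen) R (subst (_< i) (sym (count-there seen z≢y)) c<i)
        (subst (i ≤_) (cong₂ _+_ (sym (count-there seen z≢y)) (count-there R z≢y)) i≤c))
    by-cases (yes refl) with suc (count z seen) N.≟ i
    ... | yes c+1≡i = subst (z ∈L_) (sym (read-accept i z _ (label (z ∷ seen) R) c+1≡i)) (here refl)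
    ... | no c+1≢i = subst (z ∈L_) (sym (read-reject i z _ (label (z ∷ seen) R) c+1≢i))
      (∈-read i z (z ∷ seen) R (subst (_< i) (sym (count-here z seen)) c+1<i) (subst (i ≤_) shift i≤c))
      where
      c+1<i : suc (count z seen) < i
      c+1<i with m≤n⇒m<n∨m≡n c<i
      ... | inj₁ lt = lt
      ... | inj₂ eq = ⊥-elim (c+1≢i eq)
      shift : count z seen + count z (z ∷ R) ≡ count z (z ∷ seen) + count z R
      shift = begin
        count z seen + count z (z ∷ R)  ≡⟨ cong (count z seen +_) (count-here z R) ⟩
        count z seen + suc (count z R)  ≡⟨ +-suc (count z seen) (count z R) ⟩
        suc (count z seen) + count z R  ≡⟨ cong (_+ count z R) (sym (count-here z seen)) ⟩
        count z (z ∷ seen) + count z R  ∎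

  module Restriction {P : A → Set} (P? : Decidable P) where

    onElement? : Decidable (λ (e : A × ℕ) → P (proj₁ e))
    onElement? e = P? (proj₁ e)

    count-filter : ∀ {x} seen → P x → count x (filter P? seen) ≡ count x seen
    count-filter [] _ = refl
    count-filter {x} (y ∷ seen) px with P? y
    ... | yes _ = kept (x ≟A y)
      where
      kept : Dec (x ≡ y) → count x (y ∷ filter P? seen) ≡ count x (y ∷ seen)
      kept (yes refl) = trans (count-here x _) (trans (cong suc (count-filter seen px)) (sym (count-here x seen)))
      kept (no x≢y) = trans (count-there _ x≢y) (trans (count-filter seen px) (sym (count-there seen x≢y)))
    ... | no ¬py = trans (count-filter seen px) (sym (count-there seen (λ { refl → ¬py px })))

    label-filter : ∀ seen R → label (filter P? seen) (filter P? R) ≡ filter onElement? (label seen R)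
    label-filter seen [] = refl
    label-filter seen (x ∷ R) = by-cases (P? x)
      where
      by-cases : Dec (P x) → label (filter P? seen) (filter P? (x ∷ R)) ≡ filter onElement? (label seen (x ∷ R))
      by-cases (yes px) = begin
        label (filter P? seen) (filter P? (x ∷ R))
          ≡⟨ cong (label (filter P? seen)) (filter-accept P? px) ⟩
        (x , suc (count x (filter P? seen))) ∷ label (x ∷ filter P? seen) (filter P? R)
          ≡⟨ cong (λ c → (x , suc c) ∷ label (x ∷ filter P? seen) (filter P? R)) (count-filter seen px) ⟩
        (x , suc (count x seen)) ∷ label (x ∷ filter P? seen) (filter P? R)
          ≡⟨ cong (λ H → (x , suc (count x seen)) ∷ label H (filter P? R)) (sym (filter-accept P? px)) ⟩
        (x , suc (count x seen)) ∷ label (filter P? (x ∷ seen)) (filter P? R)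
          ≡⟨ cong ((x , suc (count x seen)) ∷_) (label-filter (x ∷ seen) R) ⟩
        (x , suc (count x seen)) ∷ filter onElement? (label (x ∷ seen) R)
          ≡⟨ sym (filter-accept onElement? px) ⟩
        filter onElement? (label seen (x ∷ R))  ∎
      by-cases (no ¬px) = begin
        label (filter P? seen) (filter P? (x ∷ R))  ≡⟨ cong (label (filter P? seen)) (filter-reject P? ¬px) ⟩
        label (filter P? seen) (filter P? R)        ≡⟨ cong (λ H → label H (filter P? R)) (sym (filter-reject P? ¬px)) ⟩
        label (filter P? (x ∷ seen)) (filter P? R)  ≡⟨ label-filter (x ∷ seen) R ⟩
        filter onElement? (label (x ∷ seen) R)      ≡⟨ sym (filter-reject onElement? ¬px) ⟩
        filter onElement? (label seen (x ∷ R))      ∎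

    read-filter : ∀ i L → read i (filter onElement? L) ≡ filter P? (read i L)
    read-filter i [] = refl
    read-filter i ((x , c) ∷ L) = by-cases (P? x) (c N.≟ i)
      where
      by-cases : Dec (P x) → Dec (c ≡ i) → read i (filter onElement? ((x , c) ∷ L)) ≡ filter P? (read i ((x , c) ∷ L))
      by-cases (yes px) (yes c≡i) = begin
        read i (filter onElement? ((x , c) ∷ L))  ≡⟨ cong (read i) (filter-accept onElement? px) ⟩
        read i ((x , c) ∷ filter onElement? L)    ≡⟨ read-accept i x c _ c≡i ⟩
        x ∷ read i (filter onElement? L)          ≡⟨ cong (x ∷_) (read-filter i L) ⟩
        x ∷ filter P? (read i L)                  ≡⟨ sym (filter-accept P? px) ⟩
        filter P? (x ∷ read i L)                  ≡⟨ cong (filter P?) (sym (read-accept i x c L c≡i)) ⟩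
        filter P? (read i ((x , c) ∷ L))          ∎
      by-cases (yes px) (no c≢i) = begin
        read i (filter onElement? ((x , c) ∷ L))  ≡⟨ cong (read i) (filter-accept onElement? px) ⟩
        read i ((x , c) ∷ filter onElement? L)    ≡⟨ read-reject i x c _ c≢i ⟩
        read i (filter onElement? L)              ≡⟨ read-filter i L ⟩
        filter P? (read i L)                      ≡⟨ cong (filter P?) (sym (read-reject i x c L c≢i)) ⟩
        filter P? (read i ((x , c) ∷ L))          ∎
      by-cases (no ¬px) (yes c≡i) = begin
        read i (filter onElement? ((x , c) ∷ L))  ≡⟨ cong (read i) (filter-reject onElement? ¬px) ⟩
        read i (filter onElement? L)              ≡⟨ read-filter i L ⟩
        filter P? (read i L)                      ≡⟨ sym (filter-reject P? ¬px) ⟩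
        filter P? (x ∷ read i L)                  ≡⟨ cong (filter P?) (sym (read-accept i x c L c≡i)) ⟩
        filter P? (read i ((x , c) ∷ L))          ∎
      by-cases (no ¬px) (no c≢i) = begin
        read i (filter onElement? ((x , c) ∷ L))  ≡⟨ cong (read i) (filter-reject onElement? ¬px) ⟩
        read i (filter onElement? L)              ≡⟨ read-filter i L ⟩
        filter P? (read i L)                      ≡⟨ cong (filter P?) (sym (read-reject i x c L c≢i)) ⟩
        filter P? (read i ((x , c) ∷ L))          ∎

  two-regular : ∀ S (blk : A → ℕ) → All FirstOrSecond (label [] S) →
    AllPairs (λ d e → Blocks.blockKey blk d ≤ Blocks.blockKey blk e) (label [] S) → TwoRegInterleaving _≟A_ S
  two-regular S blk labels sorted = blk , Blocks.interleaving-criterion blk (label [] S) labels sorted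

-- While scanning R after the prefix seen we keep: `pushed`, the elements
-- first read so far; the whole first read  pushed ++ firsts seen R  increases
-- in f, the rest of the second read decreases in f, and once a second
-- occurrence has been read (flag `started`) no first occurrence remains.  The
-- last clause holds because a later first occurrence y would be read twice
-- after an earlier-pushed x was read the second time, against f x < f y.
module SecondReadDecreasing {A : Set} (_≟A_ : DecidableEquality A) where
  open Occurrences _≟A_
  open Blocks {A} (λ _ → 0) using (AscendingFrom; []; _∷_)

  module _ (f : A → ℕ) where

    first-occurrences-first : ∀ seen R (started : Bool) (pushed : List A) → Balanced seen R →
      AllPairs (λ a b → f a < f b) (pushed ++ firsts seen R) →
      (∀ {z} → count z seen ≢ 0 → z ∈L pushed) →
      AllPairs (λ a b → f a > f b) (seconds seen R) →
      (started ≡ true → firsts seen R ≡ []) →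
      AscendingFrom (bit started) (label seen R)
    first-occurrences-first seen [] _ _ _ _ _ _ _ = []
    first-occurrences-first seen (x ∷ R) started pushed bal inc pushed⊇ dec no-firsts
      with next-occurrence {seen} {x} {R} bal
    ... | inj₁ c≡0 = subst (_ ≤_) (sym c≡0) not-started
                   ∷ subst (λ b → AscendingFrom b (label (x ∷ seen) R)) (sym c≡0) rest
      where
      x-first : firsts seen (x ∷ R) ≡ x ∷ firsts (x ∷ seen) R
      x-first = firsts-new seen x R c≡0
      not-started : bit started ≤ 0
      not-started = flag-off started no-firsts
        where
        flag-off : ∀ b → (b ≡ true → firsts seen (x ∷ R) ≡ []) → bit b ≤ 0
        flag-off false _ = z≤n
        flag-off true none with trans (sym x-first) (none refl)
        ... | ()
      rest : AscendingFrom 0 (label (x ∷ seen) R)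
      rest = first-occurrences-first (x ∷ seen) R false (pushed ++ x ∷ []) (balanced-step {seen} {x} {R} bal)
        (subst (AllPairs _) (trans (cong (pushed ++_) x-first) (sym (++-assoc pushed (x ∷ []) _))) inc)
        (λ {z} c≢0 → [ (λ { refl → ∈-++⁺ʳ pushed (here refl) }) , (λ c≢0' → ∈-++⁺ˡ (pushed⊇ c≢0')) ]′
                       (count-cons-≢0 seen c≢0))
        (subst (AllPairs _) (seconds-not-now seen x R (λ c≡1 → 0≢1+n (trans (sym c≡0) c≡1))) dec)
        (λ ())
    ... | inj₂ c≡1 = subst (bit started ≤_) (sym c≡1) (bit≤1 started)
                   ∷ subst (λ b → AscendingFrom b (label (x ∷ seen) R)) (sym c≡1) rest
      where
      x-seen : count x seen ≢ 0
      x-seen c≡0 = 0≢1+n (trans (sym c≡0) c≡1)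
      inc' : AllPairs (λ a b → f a < f b) (pushed ++ firsts (x ∷ seen) R)
      inc' = subst (λ L → AllPairs _ (pushed ++ L)) (firsts-old seen x R x-seen) inc
      dec-x : AllPairs (λ a b → f a > f b) (x ∷ seconds (x ∷ seen) R)
      dec-x = subst (AllPairs _) (seconds-now seen x R c≡1) dec
      -- y first read later would be read twice after x: f y < f x, yet f x < f y
      none-left : ∀ {y} → ¬ y ∈L firsts (x ∷ seen) R
      none-left {y} y∈ = <-asym (allPairs-++-cross pushed inc' (pushed⊇ x-seen) y∈)
        (All.lookup (AP.head dec-x) (∈-read 2 y (x ∷ seen) R (subst (_< 2) (sym y-unseen) (s≤s z≤n))
          (subst (2 ≤_) (sym (balanced-step {seen} {x} {R} bal y)) ≤-refl)))
        where
        y-unseen : count y (x ∷ seen) ≡ 0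
        y-unseen = All.lookup (firsts-unseen (x ∷ seen) R) y∈
      rest : AscendingFrom 1 (label (x ∷ seen) R)
      rest = first-occurrences-first (x ∷ seen) R true pushed (balanced-step {seen} {x} {R} bal) inc'
        (λ {z} c≢0 → [ (λ { refl → pushed⊇ x-seen }) , pushed⊇ ]′ (count-cons-≢0 seen c≢0))
        (AP.tail dec-x) (λ _ → no-members none-left)

  decreasing-case : ∀ S → Balanced [] S → Linked (λ a b → rank S a > rank S b) (seconds [] S) →
    TwoRegInterleaving _≟A_ S
  decreasing-case S bal dec = two-regular S (λ _ → 0) (labels-1-or-2 [] S bal)
    (Blocks.ascendingFrom⇒sorted (λ _ → 0)
      (first-occurrences-first (rank S) [] S false [] bal
        (LP.Linked⇒AllPairs <-trans (firsts-ascending [] S)) (λ unseen → ⊥-elim (unseen refl))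
        (LP.Linked⇒AllPairs (λ b>c a>b → <-trans a>b b>c) dec) (λ ())))

even : ℕ → Bool
even zero = true
even (suc n) = not (even n)

flip-≡ : ∀ {b τ} → not b ≡ τ → b ≢ τ
flip-≡ {true} refl ()
flip-≡ {false} refl ()

flip-≢ : ∀ {b τ} → not b ≢ τ → b ≡ τ
flip-≢ {true} {true} _ = refl
flip-≢ {true} {false} ne = ⊥-elim (ne refl)
flip-≢ {false} {true} ne = ⊥-elim (ne refl)
flip-≢ {false} {false} _ = refl

xor-≢ : ∀ {a b} → a ≢ b → a xor b ≡ true
xor-≢ {true} {true} ne = ⊥-elim (ne refl)
xor-≢ {true} {false} _ = refl
xor-≢ {false} {true} _ = refl
xor-≢ {false} {false} ne = ⊥-elim (ne refl)

nextGen : ℕ → Bool → ℕ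
nextGen g false = g
nextGen g true = suc g

-- The least block key a later event of parity class τ can carry when the
-- current generation is g and its flag is c: 2g + c if g belongs to the class,
-- otherwise 2g - 1 (a second occurrence of generation g - 1).
bound : Bool → ℕ → Bool → ℕ
bound τ g c = if even g xor τ then double g ∸ 1 else double g + bit c

bound-in : ∀ {τ} g c → even g ≡ τ → bound τ g c ≡ double g + bit c
bound-in {τ} g c refl rewrite xor-same τ = refl

bound-out : ∀ {τ} g c → even g ≢ τ → bound τ g c ≡ double g ∸ 1
bound-out g c ne rewrite xor-≢ ne = refl

push-passes : ∀ τ g c →
  Passes (even (nextGen g c) ≡ τ) (double (nextGen g c) + 0) (bound τ g c) (bound τ (nextGen g c) false)
push-passes τ g false = (λ k → ≤-reflexive (bound-in g false k) , ≤-reflexive (sym (bound-in g false k))) , λ _ → ≤-refl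
push-passes τ g true =
    (λ k → ≤-trans (≤-reflexive (bound-out g true (flip-≡ k)))
                   (≤-trans (m∸n≤m (double g) 1) (≤-trans (n≤1+n _) (≤-trans (n≤1+n _) (m≤m+n _ 0))))
         , ≤-reflexive (sym (bound-in (suc g) false k)))
  , λ ¬k → ≤-reflexive (trans (bound-in g true (flip-≢ ¬k)) (trans (+-comm (double g) 1) (sym (bound-out (suc g) false ¬k))))

-- The flag after popping an element of generation γ while the current
-- generation g is γ or γ + 1: it closes g exactly when γ = g.
pop-cases : ∀ {γ g} hx c → hx ≡ γ → γ ≤ g → g ≤ suc γ →
  (γ ≡ g × c ∨ does (hx N.≟ g) ≡ true) ⊎ (suc γ ≡ g × c ∨ does (hx N.≟ g) ≡ c)
pop-cases {γ} {g} hx c hx≡γ γ≤g g≤γ+1 with m≤n⇒m<n∨m≡n γ≤g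
... | inj₂ γ≡g = inj₁ (γ≡g , trans (cong (c ∨_) (D.dec-true (hx N.≟ g) (trans hx≡γ γ≡g))) (∨-zeroʳ c))
... | inj₁ γ<g = inj₂ (≤-antisym γ<g g≤γ+1
  , trans (cong (c ∨_) (D.dec-false (hx N.≟ g) (λ hx≡g → <-irrefl (trans (sym hx≡γ) hx≡g) γ<g))) (∨-identityʳ c))

pop-passes : ∀ τ g c c' γ → (γ ≡ g × c' ≡ true) ⊎ (suc γ ≡ g × c' ≡ c) →
  Passes (even γ ≡ τ) (double γ + 1) (bound τ g c) (bound τ g c')
pop-passes τ g c c' γ (inj₁ (refl , refl)) =
    (λ k → ≤-trans (≤-reflexive (bound-in g c k)) (+-monoʳ-≤ (double γ) (bit≤1 c))
         , ≤-reflexive (sym (bound-in g true k)))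
  , λ ¬k → ≤-reflexive (trans (bound-out g c ¬k) (sym (bound-out g true ¬k)))
pop-passes τ g c c' γ (inj₂ (refl , refl)) =
    (λ k → ≤-reflexive (trans (bound-out g c (λ e → flip-≡ e k)) (+-comm 1 (double γ)))
         , ≤-reflexive (trans (+-comm (double γ) 1) (sym (bound-out g c (λ e → flip-≡ e k)))))
  , λ _ → ≤-refl

module FifoSequences {A : Set} (_≟A_ : DecidableEquality A) where
  open Occurrences _≟A_

  -- Queue H Q L: the labelled events L can be executed
  -- from a state in which the elements H have been pushed and Q (front first)
  -- is queued; a push appends a fresh element, a pop removes the front.
  data Queue : List A → List A → List (A × ℕ) → Set where
    done : ∀ {H} → Queue H [] []
    push : ∀ {H Q L x} → x ∉L H → Queue (x ∷ H) (Q ++ x ∷ []) L → Queue H Q ((x , 1) ∷ L)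
    pop  : ∀ {H Q L x} → Queue (x ∷ H) Q L → Queue H (x ∷ Q) ((x , 2) ∷ L)

  queue-run : ∀ seen R Q → Balanced seen R → seconds seen R ≡ Q ++ firsts seen R → Queue seen Q (label seen R)
  queue-run seen [] [] _ _ = done
  queue-run seen [] (_ ∷ _) _ ()
  queue-run seen (x ∷ R) Q bal fifo with next-occurrence {seen} {x} {R} bal
  ... | inj₁ c≡0 = subst (λ c → Queue seen Q ((x , suc c) ∷ label (x ∷ seen) R)) (sym c≡0)
    (push (unseen⇒∉ seen c≡0) (queue-run (x ∷ seen) R (Q ++ x ∷ []) (balanced-step {seen} {x} {R} bal) fifo'))
    where
    fifo' : seconds (x ∷ seen) R ≡ (Q ++ x ∷ []) ++ firsts (x ∷ seen) R
    fifo' = begin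
      seconds (x ∷ seen) R               ≡⟨ sym (seconds-not-now seen x R (λ c≡1 → 0≢1+n (trans (sym c≡0) c≡1))) ⟩
      seconds seen (x ∷ R)               ≡⟨ fifo ⟩
      Q ++ firsts seen (x ∷ R)           ≡⟨ cong (Q ++_) (firsts-new seen x R c≡0) ⟩
      Q ++ x ∷ firsts (x ∷ seen) R       ≡⟨ sym (++-assoc Q (x ∷ []) _) ⟩
      (Q ++ x ∷ []) ++ firsts (x ∷ seen) R  ∎
  ... | inj₂ c≡1 = at-front Q fifo'
    where
    fifo' : x ∷ seconds (x ∷ seen) R ≡ Q ++ firsts (x ∷ seen) R
    fifo' = begin
      x ∷ seconds (x ∷ seen) R    ≡⟨ sym (seconds-now seen x R c≡1) ⟩
      seconds seen (x ∷ R)        ≡⟨ fifo ⟩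
      Q ++ firsts seen (x ∷ R)    ≡⟨ cong (Q ++_) (firsts-old seen x R (λ c≡0 → 0≢1+n (trans (sym c≡0) c≡1))) ⟩
      Q ++ firsts (x ∷ seen) R    ∎
    -- x, being popped, is at the front: it cannot be first read again
    at-front : ∀ Q → x ∷ seconds (x ∷ seen) R ≡ Q ++ firsts (x ∷ seen) R → Queue seen Q (label seen (x ∷ R))
    at-front [] eq = ⊥-elim (0≢1+n (sym (trans (sym (count-here x seen))
      (All.lookup (firsts-unseen (x ∷ seen) R) (subst (x ∈L_) eq (here refl))))))
    at-front (_ ∷ Q') eq with ∷-injective eq
    ... | refl , eq' = subst (λ c → Queue seen (x ∷ Q') ((x , suc c) ∷ label (x ∷ seen) R)) (sym c≡1)
      (pop (queue-run (x ∷ seen) R Q' (balanced-step {seen} {x} {R} bal) eq'))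

  -- Its state: the current generation, whether an
  -- element of the current generation has already been popped ("closed"), and
  -- the generations assigned so far.
  record GenState : Set where
    constructor ⟨_,_,_⟩
    field
      current : ℕ
      closed : Bool
      gen : A → ℕ
  open GenState

  assign : A → ℕ → (A → ℕ) → A → ℕ
  assign y v h z with z ≟A y
  ... | yes _ = v
  ... | no _ = h z

  assign-same : ∀ y v h → assign y v h y ≡ v
  assign-same y v h with y ≟A y
  ... | yes _ = refl
  ... | no y≢y = ⊥-elim (y≢y refl)

  assign-other : ∀ y v h z → z ≢ y → assign y v h z ≡ h z
  assign-other y v h z z≢y with z ≟A y
  ... | yes z≡y = ⊥-elim (z≢y z≡y)
  ... | no _ = refl

  onPush : A → GenState → GenState
  onPush x ⟨ g , c , h ⟩ = ⟨ nextGen g c , false , assign x (nextGen g c) h ⟩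

  onPop : A → GenState → GenState
  onPop x ⟨ g , c , h ⟩ = ⟨ g , c ∨ does (h x N.≟ g) , h ⟩

  generations : ∀ {H Q L} → Queue H Q L → GenState → A → ℕ
  generations done st = gen st
  generations (push {x = x} _ q) st = generations q (onPush x st)
  generations (pop {x = x} q) st = generations q (onPop x st)

  generations-pushed : ∀ {H Q L} (q : Queue H Q L) st z → z ∈L H → generations q st z ≡ gen st z
  generations-pushed done st z _ = refl
  generations-pushed (push {x = x} x∉H q) ⟨ g , c , h ⟩ z z∈H =
    trans (generations-pushed q _ z (there z∈H)) (assign-other x (nextGen g c) h z (λ { refl → x∉H z∈H }))
  generations-pushed (pop q) ⟨ g , c , h ⟩ z z∈H = generations-pushed q _ z (there z∈H)

  -- Invariant of the generation machine along a queue run, stated for the final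
  -- generations Gf: queued elements were pushed, belong to the current or the
  -- previous generation, all to the current one once it is closed, and the
  -- queue is sorted by generation.
  record Invariant (Gf : A → ℕ) (H Q : List A) (st : GenState) : Set where
    field
      queued-pushed : All (_∈L H) Q
      queued-recent : All (λ y → Gf y ≤ current st × current st ≤ suc (Gf y)) Q
      closed-current : closed st ≡ true → All (λ y → Gf y ≡ current st) Q
      queue-sorted : AllPairs (λ a b → Gf a ≤ Gf b) Q

  push-invariant : ∀ {Gf H Q x} g c h → Gf x ≡ nextGen g c → Invariant Gf H Q ⟨ g , c , h ⟩ →
    Invariant Gf (x ∷ H) (Q ++ x ∷ []) (onPush x ⟨ g , c , h ⟩)
  push-invariant {Gf} {Q = Q} {x} g c h Gx inv = record
    { queued-pushed = AllP.++⁺ (All.map there queued-pushed) (here refl ∷ [])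
    ; queued-recent = AllP.++⁺ (still-recent c closed-current queued-recent)
                               ((≤-reflexive Gx , subst (λ γ → nextGen g c ≤ suc γ) (sym Gx) (n≤1+n _)) ∷ [])
    ; closed-current = λ ()
    ; queue-sorted = APP.++⁺ queue-sorted ([] ∷ [])
        (All.map (λ (y≤g , _) → (≤-trans y≤g (≤-trans (g≤nextGen c) (≤-reflexive (sym Gx)))) ∷ []) queued-recent)
    }
    where
    open Invariant inv
    g≤nextGen : ∀ c → g ≤ nextGen g c
    g≤nextGen false = ≤-refl
    g≤nextGen true = n≤1+n g
    -- a new generation is opened only when all queued elements are current
    still-recent : ∀ c → (c ≡ true → All (λ y → Gf y ≡ g) Q) → All (λ y → Gf y ≤ g × g ≤ suc (Gf y)) Q →
      All (λ y → Gf y ≤ nextGen g c × nextGen g c ≤ suc (Gf y)) Q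
    still-recent false _ recent = recent
    still-recent true all-current _ =
      All.map (λ { refl → n≤1+n _ , ≤-refl }) (all-current refl)

  front-cases : ∀ {Gf H x Q} g c h → h x ≡ Gf x → Invariant Gf H (x ∷ Q) ⟨ g , c , h ⟩ →
    (Gf x ≡ g × closed (onPop x ⟨ g , c , h ⟩) ≡ true) ⊎ (suc (Gf x) ≡ g × closed (onPop x ⟨ g , c , h ⟩) ≡ c)
  front-cases {x = x} g c h hx inv =
    pop-cases (h x) c hx (proj₁ (All.head queued-recent)) (proj₂ (All.head queued-recent))
    where
    open Invariant inv

  pop-invariant : ∀ {Gf H x Q} g c h → h x ≡ Gf x → Invariant Gf H (x ∷ Q) ⟨ g , c , h ⟩ →
    Invariant Gf (x ∷ H) Q (onPop x ⟨ g , c , h ⟩)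
  pop-invariant {Gf} {x = x} {Q} g c h hx inv = record
    { queued-pushed = All.map there (All.tail queued-pushed)
    ; queued-recent = All.tail queued-recent
    ; closed-current = closed-current' (front-cases g c h hx inv)
    ; queue-sorted = AP.tail queue-sorted
    }
    where
    open Invariant inv
    -- popping a current element closes the generation: the rest of the queue,
    -- sorted after it, is current as well
    closed-current' : (Gf x ≡ g × closed (onPop x ⟨ g , c , h ⟩) ≡ true) ⊎ (suc (Gf x) ≡ g × closed (onPop x ⟨ g , c , h ⟩) ≡ c) →
      closed (onPop x ⟨ g , c , h ⟩) ≡ true → All (λ y → Gf y ≡ g) Q
    closed-current' (inj₁ (refl , _)) _ =
      All.zipWith (λ ((y≤g , _) , x≤y) → ≤-antisym y≤g x≤y) (All.tail queued-recent , AP.head queue-sorted)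
    closed-current' (inj₂ (_ , c'≡c)) closed' = All.tail (closed-current (trans (sym c'≡c) closed'))

  class-sorted : ∀ {H Q L} (q : Queue H Q L) st (Gf : A → ℕ) → (∀ z → generations q st z ≡ Gf z) →
    Invariant Gf H Q st → (τ : Bool) {P : A → Set} (P? : Decidable P) → (∀ x → P x ⇔ (even (Gf x) ≡ τ)) →
    Blocks.AscendingFrom Gf (bound τ (current st) (closed st)) (filter (λ e → P? (proj₁ e)) L)
  class-sorted done _ _ _ _ _ _ _ = Blocks.[]
  class-sorted (push {L = L} {x = x} _ q) ⟨ g , c , h ⟩ Gf final inv τ P? class =
    Blocks.ascendingFrom-filter-cons Gf (λ e → P? (proj₁ e)) (x , 1) L
      (passes-⇔ (class x) (subst (λ γ → Passes (even γ ≡ τ) (double γ + 0) _ _) (sym Gx) (push-passes τ g c)))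
      (class-sorted q _ Gf final (push-invariant g c h Gx inv) τ P? class)
    where
    Gx : Gf x ≡ nextGen g c
    Gx = trans (sym (final x)) (trans (generations-pushed q _ x (here refl)) (assign-same x _ h))
  class-sorted (pop {L = L} {x = x} q) ⟨ g , c , h ⟩ Gf final inv τ P? class =
    Blocks.ascendingFrom-filter-cons Gf (λ e → P? (proj₁ e)) (x , 2) L
      (passes-⇔ (class x) (pop-passes τ g c _ (Gf x) (front-cases g c h hx inv)))
      (class-sorted q _ Gf final (pop-invariant g c h hx inv) τ P? class)
    where
    hx : h x ≡ Gf x
    hx = trans (sym (generations-pushed (pop q) ⟨ g , c , h ⟩ x (All.head (Invariant.queued-pushed inv)))) (final x)

  -- Case S⁽²⁾ increasing: then S⁽²⁾ = S⁽¹⁾, since both are strictly sorted and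
  -- contain every element.
  increasing-second-read : ∀ S → Balanced [] S → Linked (λ a b → rank S a < rank S b) (seconds [] S) →
    seconds [] S ≡ firsts [] S
  increasing-second-read S bal inc = strictly-sorted-unique (rank S) (seconds [] S) (firsts [] S)
    (LP.Linked⇒AllPairs <-trans inc) (LP.Linked⇒AllPairs <-trans (firsts-ascending [] S))
    (λ {z} _ → ∈-read 1 z [] S (s≤s z≤n) (subst (1 ≤_) (sym (bal z)) (s≤s z≤n)))
    (λ {z} _ → ∈-read 2 z [] S (s≤s z≤n) (subst (2 ≤_) (sym (bal z)) ≤-refl))

  fifo-per-read-monotone : ∀ S → seconds [] S ≡ firsts [] S → PerReadMonotone _≟A_ 2 S
  fifo-per-read-monotone S _ 1 _ _ = inj₁ (firsts-ascending [] S)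
  fifo-per-read-monotone S fifo 2 _ _ = inj₁ (subst (Linked _) (sym fifo) (firsts-ascending [] S))
  fifo-per-read-monotone S _ (suc (suc (suc _))) _ (s≤s (s≤s ()))

  fifoGenerations : ∀ S → Balanced [] S → seconds [] S ≡ firsts [] S → A → ℕ
  fifoGenerations S bal fifo = generations (queue-run [] S [] bal fifo) ⟨ 0 , false , (λ _ → 0) ⟩

  module _ {P : A → Set} (P? : Decidable P) where
    open Restriction P?

    restriction-fifo : ∀ S → seconds [] S ≡ firsts [] S → seconds [] (filter P? S) ≡ firsts [] (filter P? S)
    restriction-fifo S fifo = begin
      read 2 (label [] (filter P? S))        ≡⟨ cong (read 2) (label-filter [] S) ⟩
      read 2 (filter onElement? (label [] S)) ≡⟨ read-filter 2 (label [] S) ⟩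
      filter P? (seconds [] S)               ≡⟨ cong (filter P?) fifo ⟩
      filter P? (firsts [] S)                ≡⟨ sym (read-filter 1 (label [] S)) ⟩
      read 1 (filter onElement? (label [] S)) ≡⟨ cong (read 1) (sym (label-filter [] S)) ⟩
      read 1 (label [] (filter P? S))        ∎

    parity-class : ∀ S (bal : Balanced [] S) (fifo : seconds [] S ≡ firsts [] S) (τ : Bool) →
      (∀ x → P x ⇔ (even (fifoGenerations S bal fifo x) ≡ τ)) →
      PerReadMonotone _≟A_ 2 (filter P? S) × TwoRegInterleaving _≟A_ (filter P? S)
    parity-class S bal fifo τ class =
      fifo-per-read-monotone (filter P? S) (restriction-fifo S fifo) ,
      two-regular (filter P? S) Gf
        (subst (All _) (sym (label-filter [] S)) (AllP.filter⁺ onElement? (labels-1-or-2 [] S bal)))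
        (subst (AllPairs _) (sym (label-filter [] S)) (Blocks.ascendingFrom⇒sorted Gf class-events))
      where
      Gf : A → ℕ
      Gf = fifoGenerations S bal fifo
      class-events : Blocks.AscendingFrom Gf (bound τ 0 false) (filter onElement? (label [] S))
      class-events = class-sorted (queue-run [] S [] bal fifo) _ Gf (λ _ → refl)
        (record { queued-pushed = [] ; queued-recent = [] ; closed-current = λ _ → [] ; queue-sorted = [] })
        τ P? class

restrict-⊤ : ∀ {s} (S : List (Fin s)) → restrict S ⊤ ≡ S
restrict-⊤ S = filter-all (λ x → x ∈? ⊤) (All.tabulate (λ _ → ∈⊤))

large-parity-class : ∀ {s} (g : Fin s → ℕ) → ∃[ τ ] ∃[ X ] (s ≤ 2 * ∣ X ∣ × (∀ x → x ∈S X ⇔ (even (g x) ≡ τ)))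
large-parity-class {s} g = larger (≤-total ∣ evens ∣ ∣ ∁ evens ∣)
  where
  evens : Subset s
  evens = tabulate (λ x → even (g x))
  split : ∣ evens ∣ + ∣ ∁ evens ∣ ≡ s
  split = trans (cong (∣ evens ∣ +_) (∣∁p∣≡n∸∣p∣ evens)) (m+[n∸m]≡n (∣p∣≤n evens))
  ∈evens : ∀ x → x ∈S evens ⇔ (even (g x) ≡ true)
  ∈evens x = mk⇔ (λ x∈ → trans (sym (lookup∘tabulate _ x)) ([]=⇒lookup x∈))
                  (λ ev → lookup⇒[]= x evens (trans (lookup∘tabulate _ x) ev))
  ∈odds : ∀ x → x ∈S ∁ evens ⇔ (even (g x) ≡ false)
  ∈odds x = mk⇔ (λ x∈ → ¬-not (λ ev → x∈∁p⇒x∉p x∈ (Equivalence.from (∈evens x) ev)))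
                 (λ od → x∉p⇒x∈∁p (λ x∈ → not-¬ refl (trans (sym od) (Equivalence.to (∈evens x) x∈))))
  larger : ∣ evens ∣ ≤ ∣ ∁ evens ∣ ⊎ ∣ ∁ evens ∣ ≤ ∣ evens ∣ →
    ∃[ τ ] ∃[ X ] (s ≤ 2 * ∣ X ∣ × (∀ x → x ∈S X ⇔ (even (g x) ≡ τ)))
  larger (inj₁ e≤o) = false , ∁ evens , subst (_≤ 2 * ∣ ∁ evens ∣) split (+-mono-≤ e≤o (m≤m+n _ 0)) , ∈odds
  larger (inj₂ o≤e) = true , evens , subst (_≤ 2 * ∣ evens ∣) split (+-monoʳ-≤ ∣ evens ∣ (≤-trans o≤e (m≤m+n _ 0))) , ∈evens

-- Lemma 5.8.  In fact the chosen set has at least s/2 elements.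
lemma5p8 : (s : ℕ) (S : List (Fin s)) → ReadK _≟_ 2 S → PerReadMonotone _≟_ 2 S →
    ∃[ X' ] (s ≤ 3 * ∣ X' ∣ × PerReadMonotone _≟_ 2 (restrict S X')
      × TwoRegInterleaving _≟_ (restrict S X'))
lemma5p8 s S read2 monotone = by-direction (monotone 2 (s≤s z≤n) ≤-refl)
  where
  open Occurrences (_≟_ {s})
  open SecondReadDecreasing (_≟_ {s})
  open FifoSequences (_≟_ {s})
  Result : Set
  Result = ∃[ X' ] (s ≤ 3 * ∣ X' ∣ × PerReadMonotone _≟_ 2 (restrict S X') × TwoRegInterleaving _≟_ (restrict S X'))
  keep-class : (fifo : seconds [] S ≡ firsts [] S) → Result
  keep-class fifo with large-parity-class (fifoGenerations S read2 fifo)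
  ... | τ , X , half , class = X , ≤-trans half (*-monoˡ-≤ ∣ X ∣ (n≤1+n 2)) , parity-class (_∈? X) S read2 fifo τ class
  by-direction : MonotoneIn _≟_ S (readSeq _≟_ S 2) → Result
  by-direction (inj₁ increasing) = keep-class (increasing-second-read S read2 increasing)
  by-direction (inj₂ decreasing) =
    ⊤ , subst (λ n → s ≤ 3 * n) (sym (∣⊤∣≡n s)) (m≤m+n s _) ,
    subst (PerReadMonotone _≟_ 2) (sym (restrict-⊤ S)) monotone ,
    subst (TwoRegInterleaving _≟_) (sym (restrict-⊤ S)) (decreasing-case S read2 decreasing)
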